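{- In the $F_4$ Black Hole Zeckendorf game, for every $c\in\mathbb{Z}_{\ge0}$ with $c\notin\{0,1,5\}$, the position $(0,0,c)$ is an $N$ position.
   Context: The $F_4$ Black Hole Zeckendorf game: a position is a triple $(a,b,c)$ of nonnegative integers, the numbers of pieces in the columns of weights $F_1=1$, $F_2=2$, $F_3=3$. Two players alternate moves; the available moves are: (M) if $a\ge2$, go to $(a-2,b+1,c)$; (A$_1$) if $a,b\ge1$, go to $(a-1,b-1,c+1)$; (A$_2$) if $b,c\ge1$, go to $(a,b-1,c-1)$; (S$_2$) if $b\ge2$, go to $(a+1,b-2,c+1)$; (S$_3$) if $c\ge2$, go to $(a+1,b,c-2)$ (pieces landing in column $F_4=5$, the "black hole", are removed). The player making the last move wins. A position is a $P$ position if the player to move from it loses under optimal play, and an $N$ position if the player to move can force a win; positions with no move are $P$ positions. -}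

module Defs where

open import Data.Nat using (ℕ; suc)
open import Data.Product using (_×_; _,_; Σ)

-- A position (a , b , c): numbers of pieces in the columns of weights
-- F₁ = 1, F₂ = 2, F₃ = 3.
Pos : Set
Pos = ℕ × ℕ × ℕ

data Move : Pos → Pos → Set where
  M  : ∀ {a b c} → Move (suc (suc a) , b , c) (a , suc b , c)
  A₁ : ∀ {a b c} → Move (suc a , suc b , c) (a , b , suc c)
  A₂ : ∀ {a b c} → Move (a , suc b , suc c) (a , b , c)
  S₂ : ∀ {a b c} → Move (a , suc (suc b) , c) (suc a , b , suc c)
  S₃ : ∀ {a b c} → Move (a , b , suc (suc c)) (suc a , b , c)

-- P / N positions under normal play (last mover wins), defined inductively:
-- a position is P if every move leads to an N position (in particular a
-- position with no move is P); it is N if some move leads to a P position.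
mutual
  data IsP (x : Pos) : Set where
    allN : (∀ y → Move x y → IsN y) → IsP x

  data IsN (x : Pos) : Set where
    someP : (y : Pos) → Move x y → IsP y → IsN x

{-# OPTIONS --safe #-}
module Submission where

open import Defs
open import Data.Nat using (ℕ; suc; _+_; _≟_)
open import Data.Product using (_,_)
open import Function using (_∘_)
open import Relation.Binary.PropositionalEquality using (_≢_; refl; cong)
open import Relation.Nullary using (yes; no; contradiction)

-- Five families of positions are treated simultaneously, by recursion on
-- the number c of pieces in the F₃ column:
--   (0,0,c) is N unless c ∈ {0,1,5}    (play S₃ to (1,0,c-2)),
--   (1,0,c) is P unless c = 3          (its only move is S₃ to (2,0,c-2)),
--   (2,0,c) is N unless c = 1          (play M to (0,1,c), or S₃ when c ∈ {2,6}),
--   (0,1,c) is P unless c ∈ {1,2,6}    (its moves A₂, S₃ reach (0,0,c-1), (1,1,c-2)),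
--   (1,1,c) is N for every c           (play A₂ to (1,0,c-1), or A₁ when c ∈ {0,4}).
-- Every step lowers c except (2,0,c) → (0,1,c), which is followed by one that
-- does; the exceptional moves lead to a few small positions settled by hand.

isP-201 : IsP (2 , 0 , 1)
isP-201 = allN λ { _ M → someP _ A₂ (allN λ _ ()) }

isP-005 : IsP (0 , 0 , 5)
isP-005 = allN λ { _ S₃ → someP _ S₃ isP-201 }

isP-500 : IsP (5 , 0 , 0)
isP-500 = allN λ { _ M → someP _ A₁ isP-201 }

isN-110 : IsN (1 , 1 , 0)
isN-110 = someP _ A₁ (allN λ _ ())

isN-114 : IsN (1 , 1 , 4)
isN-114 = someP _ A₁ isP-005

isP-300 : IsP (3 , 0 , 0)
isP-300 = allN λ { _ M → isN-110 }

isP-304 : IsP (3 , 0 , 4)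
isP-304 = allN λ
  { _ M  → isN-114
  ; _ S₃ → someP _ S₃ isP-500
  }

mutual
  isN-00c : ∀ c → c ≢ 0 → c ≢ 1 → c ≢ 5 → IsN (0 , 0 , c)
  isN-00c 0 c≢0 _ _ = contradiction refl c≢0
  isN-00c 1 _ c≢1 _ = contradiction refl c≢1
  isN-00c (suc (suc c)) _ _ c≢5 = someP _ S₃ (isP-10c c (c≢5 ∘ cong (2 +_)))

  isP-10c : ∀ c → c ≢ 3 → IsP (1 , 0 , c)
  isP-10c 0 _ = allN λ _ ()
  isP-10c 1 _ = allN λ _ ()
  isP-10c (suc (suc c)) c≢3 = allN λ { _ S₃ → isN-20c c (c≢3 ∘ cong (2 +_)) }

  isN-20c : ∀ c → c ≢ 1 → IsN (2 , 0 , c)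
  isN-20c c c≢1 with c ≟ 2 | c ≟ 6
  ... | yes refl | _        = someP _ S₃ isP-300
  ... | _        | yes refl = someP _ S₃ isP-304
  ... | no c≢2   | no c≢6   = someP _ M (isP-01c c c≢1 c≢2 c≢6)

  isP-01c : ∀ c → c ≢ 1 → c ≢ 2 → c ≢ 6 → IsP (0 , 1 , c)
  isP-01c 0 _ _ _ = allN λ _ ()
  isP-01c (suc c) c≢1 c≢2 c≢6 = allN λ
    { _ A₂ → isN-00c c (c≢1 ∘ cong suc) (c≢2 ∘ cong suc) (c≢6 ∘ cong suc)
    ; _ S₃ → isN-11c _
    }

  isN-11c : ∀ c → IsN (1 , 1 , c)
  isN-11c 0 = isN-110
  isN-11c (suc c) with c ≟ 3
  ... | yes refl = isN-114
  ... | no c≢3   = someP _ A₂ (isP-10c c c≢3)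

theorem5p3 : (c : ℕ) → c ≢ 0 → c ≢ 1 → c ≢ 5 → IsN (0 , 0 , c)
theorem5p3 = isN-00c
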